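{- If $F$ is a $(0,1)$-matrix and $r\ge3$, then for every positive integer $m$, \[\operatorname{forb}(m,r,F)\le\sum_{k=0}^m\binom{m}{k}(r-2)^{m-k}\operatorname{forb}(k,F).\]
   Context: An $r$-matrix is a matrix with entries in $\{0,1,\dots,r-1\}$. A matrix is simple if it has no repeated columns. For matrices $F$ and $A$, $A$ avoids $F$ if no submatrix of $A$ is a row and column permutation of $F$. $\operatorname{forb}(m,r,F)$ is the maximum number of columns of a simple $m$-rowed $r$-matrix that avoids $F$, and $\operatorname{forb}(k,F)=\operatorname{forb}(k,2,F)$, with the convention $\operatorname{forb}(0,F)=1$. -}

module Defs where

open import Data.Nat using (ℕ; zero; suc; _+_; _*_; _∸_; _^_; _≤_)
open import Data.Nat.Combinatorics using (_C_)
open import Data.Fin using (Fin; toℕ)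
open import Data.List using (List; map; upTo)
open import Data.Nat.ListAction using (sum)
open import Data.Empty using (⊥)
open import Relation.Nullary using (¬_)
open import Data.Product using (Σ; _×_)
open import Relation.Binary.PropositionalEquality using (_≡_)
open import Function.Definitions using (Injective)

Matrix : ℕ → ℕ → ℕ → Set
Matrix r m n = Fin m → Fin n → Fin r

Simple : ∀ {r m n} → Matrix r m n → Set
Simple {r} {m} {n} A = (j j′ : Fin n) → ((i : Fin m) → A i j ≡ A i j′) → j ≡ j′

-- A contains F as a configuration: some submatrix of A is a row and column
-- permutation of F, i.e. there are injective row / column selections
-- ρ, γ with A (ρ i) (γ j) = F i j (entries compared as natural numbers).
Contains : ∀ {r m n s p q} → Matrix r m n → Matrix s p q → Set
Contains {r} {m} {n} {s} {p} {q} A F =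
  Σ (Fin p → Fin m) λ ρ → Σ (Fin q → Fin n) λ γ →
    Injective _≡_ _≡_ ρ × Injective _≡_ _≡_ γ ×
    ((i : Fin p) (j : Fin q) → toℕ (A (ρ i) (γ j)) ≡ toℕ (F i j))

Avoids : ∀ {r m n s p q} → Matrix r m n → Matrix s p q → Set
Avoids A F = ¬ Contains A F

-- IsForb m r F N :  N = forb(m, r, F), i.e. N is the maximum number of
-- columns of a simple m-rowed r-matrix avoiding F.
IsForb : ∀ {s p q} → ℕ → ℕ → Matrix s p q → ℕ → Set
IsForb m r F N =
  Σ (Matrix r m N) (λ A → Simple A × Avoids A F) ×
  ((n : ℕ) (A : Matrix r m n) → Simple A → Avoids A F → n ≤ N)

boundSum : ℕ → ℕ → (ℕ → ℕ) → ℕ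
boundSum m r f = sum (map (λ k → (m C k) * ((r ∸ 2) ^ (m ∸ k)) * f k) (upTo (suc m)))

module Submission where

-- Write r = t + 2.  Give each entry of an r-matrix a class: 0 and 1 are the binary
-- entries (class 0), the entry v + 2 has class v + 1, so classes range over 0..t.
-- A column then has a class vector w, and its binary rows are the rows where w is 0.
-- Fix a simple F-avoiding m-rowed r-matrix A and a class vector w with k binary rows.
-- The columns of class vector w, restricted to those k rows, form a simple (0,1)-matrix
-- (outside the binary rows the class fixes the entry) which is a configuration of A,
-- hence avoids F; so there are at most forb(k, F) of them.  Summing over the
-- C(m,k) t^(m-k) class vectors with k binary rows gives the bound.

open import Defs
open import Data.Nat using (ℕ; _≤_)
open import Data.Fin using (Fin)
open import Relation.Binary.PropositionalEquality using (_≡_)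

open import Data.Nat using (zero; suc; _+_; _*_; _∸_; _^_; _<_; z≤n; s≤s; _≟_; _<?_)
open import Data.Nat.Properties
  using ( +-assoc; +-comm; +-suc; +-identityʳ; *-assoc; *-zeroʳ; *-distribˡ-+; *-distribʳ-+
        ; +-∸-assoc; ≤-refl; ≤-reflexive; ≤-trans; n≤1+n; n<1+n; ≮⇒≥; +-mono-≤
        ; suc-injective; +-commutativeSemigroup; *-commutativeSemigroup; module ≤-Reasoning )
open import Data.Nat.Combinatorics using (_C_; nCk+nC[k+1]≡[n+1]C[k+1]; k>n⇒nCk≡0)
open import Data.Nat.ListAction using (sum)
open import Data.Nat.Tactic.RingSolver using (solve-∀)
open import Algebra.Properties.CommutativeSemigroup +-commutativeSemigroup
  using () renaming (interchange to +-interchange)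
open import Algebra.Properties.CommutativeSemigroup *-commutativeSemigroup
  using () renaming (x∙yz≈y∙xz to *-left-swap)
open import Data.Bool using (true; false)
open import Data.Fin using (zero; suc; toℕ)
open import Data.Fin.Properties using (toℕ-injective; toℕ<n)
open import Data.Vec.Functional as Vector using ()
open import Data.List using (List; []; _∷_; map; applyUpTo; length; lookup; filter; tabulate; allFin)
open import Data.List.Properties using (filter-accept; map-tabulate; length-filter; length-tabulate)
open import Data.List.Relation.Unary.All as All using (All; []; _∷_)
open import Data.List.Relation.Unary.All.Properties using (all-filter) renaming (filter⁺ to All-filter⁺)
open import Data.List.Relation.Unary.AllPairs using (_∷_)
open import Data.List.Relation.Unary.Any as Any using ()
open import Data.List.Relation.Unary.Any.Properties using (lookup-index)
open import Data.List.Relation.Unary.Unique.Propositional using (Unique)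
open import Data.List.Relation.Unary.Unique.Propositional.Properties as Unique using (allFin⁺)
open import Data.List.Membership.Propositional using (_∈_)
open import Data.List.Membership.Propositional.Properties using (∈-lookup; ∈-filter⁺; ∈-allFin)
open import Data.Product using (_×_; _,_; proj₂)
open import Data.Empty using (⊥-elim)
open import Data.Unit using (⊤; tt)
open import Function using (_∘_)
open import Relation.Nullary using (Dec; does; yes; no)
open import Relation.Unary using (Pred; Decidable)
open import Relation.Binary.PropositionalEquality
  using (refl; sym; trans; cong; cong₂; subst; module ≡-Reasoning)

-- Σ_{k<n} h k, by recursion on the front so that re-indexing k ↦ k+1 is definitional.
sumBelow : ℕ → (ℕ → ℕ) → ℕ
sumBelow zero    h = 0
sumBelow (suc n) h = h 0 + sumBelow n (h ∘ suc)

sum-map-applyUpTo : ∀ (h f : ℕ → ℕ) n →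
  sum (map h (applyUpTo f n)) ≡ sumBelow n (h ∘ f)
sum-map-applyUpTo h f zero    = refl
sum-map-applyUpTo h f (suc n) = cong (h (f 0) +_) (sum-map-applyUpTo h (f ∘ suc) n)

sumBelow-cong : ∀ n {a b : ℕ → ℕ} → (∀ k → a k ≡ b k) → sumBelow n a ≡ sumBelow n b
sumBelow-cong zero    a≗b = refl
sumBelow-cong (suc n) a≗b = cong₂ _+_ (a≗b 0) (sumBelow-cong n (a≗b ∘ suc))

sumBelow-mono : ∀ n {a b : ℕ → ℕ} → (∀ k → a k ≤ b k) → sumBelow n a ≤ sumBelow n b
sumBelow-mono zero    a≤b = z≤n
sumBelow-mono (suc n) a≤b = +-mono-≤ (a≤b 0) (sumBelow-mono n (a≤b ∘ suc))

sumBelow-+ : ∀ n (a b : ℕ → ℕ) →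
  sumBelow n (λ k → a k + b k) ≡ sumBelow n a + sumBelow n b
sumBelow-+ zero    a b = refl
sumBelow-+ (suc n) a b = begin
  a 0 + b 0 + sumBelow n (λ k → a (suc k) + b (suc k))
    ≡⟨ cong (a 0 + b 0 +_) (sumBelow-+ n (a ∘ suc) (b ∘ suc)) ⟩
  a 0 + b 0 + (sumBelow n (a ∘ suc) + sumBelow n (b ∘ suc))
    ≡⟨ +-interchange (a 0) (b 0) _ _ ⟩
  a 0 + sumBelow n (a ∘ suc) + (b 0 + sumBelow n (b ∘ suc)) ∎
  where open ≡-Reasoning

sumBelow-*ˡ : ∀ n t (a : ℕ → ℕ) → sumBelow n (λ k → t * a k) ≡ t * sumBelow n a
sumBelow-*ˡ zero    t a = sym (*-zeroʳ t)
sumBelow-*ˡ (suc n) t a =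
  trans (cong (t * a 0 +_) (sumBelow-*ˡ n t (a ∘ suc))) (sym (*-distribˡ-+ t (a 0) _))

sumBelow-const : ∀ n c → sumBelow n (λ _ → c) ≡ n * c
sumBelow-const zero    c = refl
sumBelow-const (suc n) c = cong (c +_) (sumBelow-const n c)

sumBelow-last : ∀ n h → sumBelow (suc n) h ≡ sumBelow n h + h n
sumBelow-last zero    h = +-comm (h 0) 0
sumBelow-last (suc n) h =
  trans (cong (h 0 +_) (sumBelow-last n (h ∘ suc))) (sym (+-assoc (h 0) _ _))

module Binomial (t : ℕ) where

  weight : ℕ → ℕ → ℕ
  weight m k = (m C k) * t ^ (m ∸ k)

  binomialSum : ℕ → (ℕ → ℕ) → ℕ
  binomialSum m g = sumBelow (suc m) (λ k → weight m k * g k)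

  binomialSum-zero : ∀ g → binomialSum 0 g ≡ g 0
  binomialSum-zero g = trans (+-identityʳ _) (+-identityʳ (g 0))

  -- C(m,k+1) t^(m-k) = t · C(m,k+1) t^(m-k-1); when k ≥ m both sides vanish.
  weight-shift : ∀ m k → (m C suc k) * t ^ (m ∸ k) ≡ t * weight m (suc k)
  weight-shift m k with k <? m
  ... | yes k<m = begin
    (m C suc k) * t ^ (m ∸ k)             ≡⟨ cong (λ e → (m C suc k) * t ^ e) (+-∸-assoc 1 k<m) ⟩
    (m C suc k) * (t * t ^ (m ∸ suc k))   ≡⟨ *-left-swap (m C suc k) t _ ⟩
    t * weight m (suc k)                   ∎
    where open ≡-Reasoning
  ... | no k≮m rewrite k>n⇒nCk≡0 {m} {suc k} (s≤s (≮⇒≥ k≮m)) = sym (*-zeroʳ t)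

  weight-pascal : ∀ m k → weight (suc m) (suc k) ≡ weight m k + t * weight m (suc k)
  weight-pascal m k = begin
    (suc m C suc k) * t ^ (m ∸ k)
      ≡⟨ cong (_* t ^ (m ∸ k)) (sym (nCk+nC[k+1]≡[n+1]C[k+1] m k)) ⟩
    ((m C k) + (m C suc k)) * t ^ (m ∸ k)
      ≡⟨ *-distribʳ-+ (t ^ (m ∸ k)) (m C k) (m C suc k) ⟩
    weight m k + (m C suc k) * t ^ (m ∸ k)
      ≡⟨ cong (weight m k +_) (weight-shift m k) ⟩
    weight m k + t * weight m (suc k) ∎
    where open ≡-Reasoning

  weight-head : ∀ m → weight (suc m) 0 ≡ t * weight m 0
  weight-head m = *-left-swap 1 t (t ^ m)

  weight-beyond : ∀ m → weight m (suc m) ≡ 0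
  weight-beyond m = cong (_* t ^ (m ∸ suc m)) (k>n⇒nCk≡0 (n<1+n m))

  -- The recurrence S(m+1, g) = S(m, g ∘ suc) + t · S(m, g).  It mirrors the choice
  -- for one coordinate: class 0 (one more binary row) or one of t other classes.
  binomialSum-step : ∀ m g → binomialSum (suc m) g ≡ binomialSum m (g ∘ suc) + t * binomialSum m g
  binomialSum-step m g = begin
    weight (suc m) 0 * g 0 + sumBelow (suc m) (λ k → weight (suc m) (suc k) * g (suc k))
      ≡⟨ cong₂ (λ w s → w * g 0 + s) (weight-head m) (sumBelow-cong (suc m) split) ⟩
    t * weight m 0 * g 0 + sumBelow (suc m) (λ k → weight m k * g (suc k) + t * tail k)
      ≡⟨ cong (t * weight m 0 * g 0 +_) (sumBelow-+ (suc m) (λ k → weight m k * g (suc k)) (λ k → t * tail k)) ⟩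
    t * weight m 0 * g 0 + (shifted + sumBelow (suc m) (λ k → t * tail k))
      ≡⟨ cong (λ s → t * weight m 0 * g 0 + (shifted + s)) (sumBelow-*ˡ (suc m) t tail) ⟩
    t * weight m 0 * g 0 + (shifted + t * sumBelow (suc m) tail)
      ≡⟨ cong₂ (λ a s → a + (shifted + t * s)) (*-assoc t (weight m 0) (g 0)) tail-sum ⟩
    t * (weight m 0 * g 0) + (shifted + t * sumBelow m tail)
      ≡⟨ rearrange t (weight m 0 * g 0) shifted (sumBelow m tail) ⟩
    shifted + t * binomialSum m g ∎
    where
    open ≡-Reasoning
    shifted : ℕ
    shifted = binomialSum m (g ∘ suc)

    tail : ℕ → ℕ
    tail k = weight m (suc k) * g (suc k)

    split : ∀ k → weight (suc m) (suc k) * g (suc k) ≡ weight m k * g (suc k) + t * tail k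
    split k = begin
      weight (suc m) (suc k) * g (suc k)                        ≡⟨ cong (_* g (suc k)) (weight-pascal m k) ⟩
      (weight m k + t * weight m (suc k)) * g (suc k)           ≡⟨ *-distribʳ-+ (g (suc k)) (weight m k) _ ⟩
      weight m k * g (suc k) + t * weight m (suc k) * g (suc k) ≡⟨ cong (weight m k * g (suc k) +_) (*-assoc t _ _) ⟩
      weight m k * g (suc k) + t * tail k                       ∎

    tail-sum : sumBelow (suc m) tail ≡ sumBelow m tail
    tail-sum = begin
      sumBelow (suc m) tail      ≡⟨ sumBelow-last m tail ⟩
      sumBelow m tail + tail m   ≡⟨ cong (λ w → sumBelow m tail + w * g (suc m)) (weight-beyond m) ⟩
      sumBelow m tail + 0        ≡⟨ +-identityʳ _ ⟩
      sumBelow m tail            ∎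

    rearrange : ∀ t a b c → t * a + (b + t * c) ≡ b + t * (a + c)
    rearrange = solve-∀

lookup-injective : ∀ {X : Set} {xs : List X} → Unique xs →
  ∀ i j → lookup xs i ≡ lookup xs j → i ≡ j
lookup-injective (x∉xs ∷ u) zero    zero    _ = refl
lookup-injective (x∉xs ∷ u) zero    (suc j) e = ⊥-elim (All.lookup x∉xs (∈-lookup j) e)
lookup-injective (x∉xs ∷ u) (suc i) zero    e = ⊥-elim (All.lookup x∉xs (∈-lookup i) (sym e))
lookup-injective (x∉xs ∷ u) (suc i) (suc j) e = cong suc (lookup-injective u i j e)

length-filter-map : ∀ {ℓ} {X Y : Set} {P : Pred Y ℓ} (P? : Decidable P) (f : X → Y) xs →
  length (filter P? (map f xs)) ≡ length (filter (λ x → P? (f x)) xs)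
length-filter-map P? f []       = refl
length-filter-map P? f (x ∷ xs) with does (P? (f x))
... | true  = cong suc (length-filter-map P? f xs)
... | false = length-filter-map P? f xs

length-filter-∷ : ∀ {ℓ} {X : Set} {P : Pred X ℓ} (P? : Decidable P) x xs →
  length (filter P? xs) ≤ length (filter P? (x ∷ xs))
length-filter-∷ P? x xs with does (P? x)
... | true  = n≤1+n _
... | false = ≤-refl

sumBelow-bump : ∀ n j {a b : ℕ → ℕ} → j < n → (∀ k → a k ≤ b k) → a j < b j →
  sumBelow n a < sumBelow n b
sumBelow-bump (suc n) zero    _         a≤b aj<bj = +-mono-≤ aj<bj (sumBelow-mono n (a≤b ∘ suc))
sumBelow-bump (suc n) (suc j) {a} {b} (s≤s j<n) a≤b aj<bj =
  subst (_≤ sumBelow (suc n) b) (+-suc (a 0) _) (+-mono-≤ (a≤b 0) (sumBelow-bump n j j<n (a≤b ∘ suc) aj<bj))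

length≤Σclasses : ∀ {X : Set} (c : X → ℕ) K (xs : List X) → All (λ x → c x < K) xs →
  length xs ≤ sumBelow K (λ k → length (filter (λ x → c x ≟ k) xs))
length≤Σclasses c K []       []           = z≤n
length≤Σclasses c K (x ∷ xs) (cx<K ∷ c<K) =
  ≤-trans (s≤s (length≤Σclasses c K xs c<K))
          (sumBelow-bump K (c x) cx<K (λ k → length-filter-∷ (λ y → c y ≟ k) x xs) grows)
  where
  grows : length (filter (λ y → c y ≟ c x) xs) < length (filter (λ y → c y ≟ c x) (x ∷ xs))
  grows = ≤-reflexive (sym (cong length (filter-accept (λ y → c y ≟ c x) refl)))

-- A class vector w : Fin m → ℕ records, for each row, the class of an entry; class 0
-- marks a binary row.  zeroCoords w lists the binary rows, zeros w counts them.
zeroCoords : ∀ {m} → (Fin m → ℕ) → List (Fin m)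
zeroCoords {m} w = filter (λ i → w i ≟ 0) (allFin m)

zeros : ∀ {m} → (Fin m → ℕ) → ℕ
zeros w = length (zeroCoords w)

zeros≤ : ∀ {m} (w : Fin m → ℕ) → zeros w ≤ m
zeros≤ {m} w = ≤-trans (length-filter (λ i → w i ≟ 0) (allFin m)) (≤-reflexive (length-tabulate (λ i → i)))

isZero : ℕ → ℕ
isZero zero    = 1
isZero (suc _) = 0

zeros-tail : ∀ {m} k (w : Fin m → ℕ) →
  length (filter (λ i → (k Vector.∷ w) i ≟ 0) (tabulate suc)) ≡ zeros w
zeros-tail {m} k w = begin
  length (filter P? (tabulate suc))      ≡⟨ cong (length ∘ filter P?) (sym (map-tabulate (λ i → i) suc)) ⟩
  length (filter P? (map suc (allFin m))) ≡⟨ length-filter-map P? suc (allFin m) ⟩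
  zeros w                                 ∎
  where
  open ≡-Reasoning
  P? : (i : Fin (suc m)) → Dec ((k Vector.∷ w) i ≡ 0)
  P? i = (k Vector.∷ w) i ≟ 0

zeros-∷ : ∀ {m} k (w : Fin m → ℕ) → zeros (k Vector.∷ w) ≡ isZero k + zeros w
zeros-∷ zero    w = cong suc (zeros-tail zero w)
zeros-∷ (suc v) w = zeros-tail (suc v) w

-- The predicate P restricts attention to part of X,
-- which is what makes the induction on m (splitting off the first coordinate) go through.
module ClassCounting (t : ℕ) {X : Set} where
  open Binomial t

  SharesClass : ∀ {m} → (X → Fin m → ℕ) → (Fin m → ℕ) → X → Set
  SharesClass c w x = ∀ i → c x i ≡ w i

  FibreBound : ∀ {m} → (X → Set) → (X → Fin m → ℕ) → (ℕ → ℕ) → Set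
  FibreBound P c g = ∀ w (M : List X) → Unique M →
    All (λ x → P x × SharesClass c w x) M → length M ≤ g (zeros w)

  fix-first : ∀ {m} (P : X → Set) (c : X → Fin (suc m) → ℕ) g k → FibreBound P c g →
    FibreBound (λ x → P x × c x zero ≡ k) (λ x → c x ∘ suc) (λ z → g (isZero k + z))
  fix-first P c g k bound w M uM inM =
    subst (λ z → length M ≤ g z) (zeros-∷ k w) (bound (k Vector.∷ w) M uM (All.map extend inM))
    where
    extend : ∀ {x} → (P x × c x zero ≡ k) × SharesClass (λ x → c x ∘ suc) w x →
             P x × SharesClass c (k Vector.∷ w) x
    extend ((px , first) , rest) = px , λ { zero → first ; (suc i) → rest i }

  -- The counting lemma: split by the class of the first coordinate and recurse.
  fibre-count : ∀ m (c : X → Fin m → ℕ) → (∀ x i → c x i < suc t) →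
    ∀ P g → FibreBound P c g → ∀ L → Unique L → All P L → length L ≤ binomialSum m g
  fibre-count zero    c bounded P g bound L uL pL =
    subst (length L ≤_) (sym (binomialSum-zero g)) (bound (λ ()) L uL (All.map (λ px → px , λ ()) pL))
  fibre-count (suc m) c bounded P g bound L uL pL = begin
    length L
      ≤⟨ length≤Σclasses (λ x → c x zero) (suc t) L (All.universal (λ x → bounded x zero) L) ⟩
    length (part 0) + sumBelow t (λ v → length (part (suc v)))
      ≤⟨ +-mono-≤ (count-part 0) (sumBelow-mono t (count-part ∘ suc)) ⟩
    binomialSum m (g ∘ suc) + sumBelow t (λ _ → binomialSum m g)
      ≡⟨ cong (binomialSum m (g ∘ suc) +_) (sumBelow-const t (binomialSum m g)) ⟩
    binomialSum m (g ∘ suc) + t * binomialSum m g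
      ≡⟨ sym (binomialSum-step m g) ⟩
    binomialSum (suc m) g ∎
    where
    open ≤-Reasoning
    part : ℕ → List X
    part k = filter (λ x → c x zero ≟ k) L

    count-part : ∀ k → length (part k) ≤ binomialSum m (λ z → g (isZero k + z))
    count-part k = fibre-count m (λ x → c x ∘ suc) (λ x → bounded x ∘ suc) _ (λ z → g (isZero k + z))
      (fix-first P c g k bound) (part k) (Unique.filter⁺ _ uL)
      (All.zip (All-filter⁺ _ pL , all-filter _ L))

contains-trans : ∀ {r m n s p q u a b} {A : Matrix r m n} {B : Matrix s p q} {C : Matrix u a b} →
  Contains A B → Contains B C → Contains A C
contains-trans (ρ , γ , ρ-inj , γ-inj , A≈B) (ρ′ , γ′ , ρ′-inj , γ′-inj , B≈C) =
  ρ ∘ ρ′ , γ ∘ γ′ , ρ′-inj ∘ ρ-inj , γ′-inj ∘ γ-inj ,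
  λ i j → trans (A≈B (ρ′ i) (γ′ j)) (B≈C i j)

simple-no-rows : ∀ {r n} (B : Matrix r 0 n) → Simple B → n ≤ 1
simple-no-rows {n = zero}        B simple = z≤n
simple-no-rows {n = suc zero}    B simple = ≤-refl
simple-no-rows {n = suc (suc n)} B simple with simple zero (suc zero) (λ ())
... | ()

forb-bound : ∀ {p q} (F : Matrix 2 p q) m (f : ℕ → ℕ) → f 0 ≡ 1 →
  ((k : ℕ) → 1 ≤ k → k ≤ m → IsForb k 2 F (f k)) →
  ∀ {k n} (B : Matrix 2 k n) → Simple B → Avoids B F → k ≤ m → n ≤ f k
forb-bound F m f f0 forb {zero}  B simple avoids _   = subst (_ ≤_) (sym f0) (simple-no-rows B simple)
forb-bound F m f f0 forb {suc k} B simple avoids k≤m = proj₂ (forb (suc k) (s≤s z≤n) k≤m) _ B simple avoids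

-- Entries of an r-matrix, r = t + 2.  The entries 0 and 1 form class 0 (binary
-- entries); the entry v + 2 forms class v + 1.  An entry is determined by its class
-- together with its binary part.
module Classes (t : ℕ) where

  class : Fin (2 + t) → ℕ
  class x = toℕ x ∸ 1

  class< : ∀ x → class x < suc t
  class< zero    = s≤s z≤n
  class< (suc x) = toℕ<n x

  binary : Fin (2 + t) → Fin 2
  binary zero          = zero
  binary (suc zero)    = suc zero
  binary (suc (suc _)) = zero

  binary-toℕ : ∀ x → class x ≡ 0 → toℕ (binary x) ≡ toℕ x
  binary-toℕ zero       _ = refl
  binary-toℕ (suc zero) _ = refl

  entry-determined : ∀ x y → class x ≡ class y → (class x ≡ 0 → binary x ≡ binary y) → x ≡ y
  entry-determined zero          zero          _ _ = refl
  entry-determined (suc zero)    (suc zero)    _ _ = refl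
  entry-determined zero          (suc zero)    _ same with same refl
  ... | ()
  entry-determined (suc zero)    zero          _ same with same refl
  ... | ()
  entry-determined (suc (suc x)) (suc (suc y)) e _ = cong (λ z → suc (suc z)) (toℕ-injective (suc-injective e))

  classes : ∀ {m N} → Matrix (2 + t) m N → Fin N → Fin m → ℕ
  classes A j i = class (A i j)

  fibreMatrix : ∀ {m N} → Matrix (2 + t) m N → (w : Fin m → ℕ) (M : List (Fin N)) →
    Matrix 2 (zeros w) (length M)
  fibreMatrix A w M i j = binary (A (lookup (zeroCoords w) i) (lookup M j))

  module _ {m N} (A : Matrix (2 + t) m N) (w : Fin m → ℕ) (M : List (Fin N)) (uM : Unique M)
           (inM : All (λ j → ∀ i → classes A j i ≡ w i) M) where

    private
      R : List (Fin m)
      R = zeroCoords w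

      uR : Unique R
      uR = Unique.filter⁺ _ (allFin⁺ m)

      in-fibre : ∀ j i → class (A i (lookup M j)) ≡ w i
      in-fibre j = All.lookup inM (∈-lookup j)

      binary-row : ∀ k → w (lookup R k) ≡ 0
      binary-row k = All.lookup (all-filter _ (allFin m)) (∈-lookup k)

    fibre-in-A : Contains A (fibreMatrix A w M)
    fibre-in-A = lookup R , lookup M , lookup-injective uR _ _ , lookup-injective uM _ _ ,
      λ i j → sym (binary-toℕ _ (trans (in-fibre j (lookup R i)) (binary-row i)))

    -- ... and it is simple when A is: two columns agreeing on the binary rows agree
    -- everywhere, since on the other rows the class already fixes the entry.
    fibre-simple : Simple A → Simple (fibreMatrix A w M)
    fibre-simple simple j j′ same = lookup-injective uM j j′ (simple _ _ λ i →
      entry-determined _ _ (trans (in-fibre j i) (sym (in-fibre j′ i))) (agree-on-binary i))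
      where
      agree-on-binary : ∀ i → class (A i (lookup M j)) ≡ 0 →
        binary (A i (lookup M j)) ≡ binary (A i (lookup M j′))
      agree-on-binary i cl0 = subst (λ i → binary (A i (lookup M j)) ≡ binary (A i (lookup M j′)))
        (sym (lookup-index i∈R)) (same (Any.index i∈R))
        where
        i∈R : i ∈ R
        i∈R = ∈-filter⁺ (λ i → w i ≟ 0) (∈-allFin i) (trans (sym (in-fibre j i)) cl0)

lemma2p1 : ∀ {p q} (F : Matrix 2 p q) (r : ℕ) → 3 ≤ r → (m : ℕ) → 1 ≤ m →
    (f : ℕ → ℕ) → f 0 ≡ 1 → ((k : ℕ) → 1 ≤ k → k ≤ m → IsForb k 2 F (f k)) →
    (N : ℕ) → IsForb m r F N → N ≤ boundSum m r f
lemma2p1 F (suc (suc t)) (s≤s (s≤s _)) m _ f f0 forb N ((A , simple , avoids) , _) = begin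
  N                            ≡⟨ sym (length-tabulate (λ j → j)) ⟩
  length (allFin N)            ≤⟨ fibre-count m (classes A) (λ j i → class< (A i j)) (λ _ → ⊤) f
                                    fibres-bounded (allFin N) (allFin⁺ N) (All.universal (λ _ → tt) _) ⟩
  binomialSum m f              ≡⟨ sym (sum-map-applyUpTo _ (λ k → k) (suc m)) ⟩
  boundSum m (suc (suc t)) f   ∎
  where
  open ≤-Reasoning
  open Classes t
  open Binomial t
  open ClassCounting t

  fibres-bounded : FibreBound (λ _ → ⊤) (classes A) f
  fibres-bounded w M uM inM = forb-bound F m f f0 forb (fibreMatrix A w M)
    (fibre-simple A w M uM inM′ simple)
    (λ contains → avoids (contains-trans {A = A} (fibre-in-A A w M uM inM′) contains))
    (zeros≤ w)
    where
    inM′ : All (λ j → ∀ i → classes A j i ≡ w i) M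
    inM′ = All.map proj₂ inM
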